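{- For every real $0<r\le 1$ and all positive integers $n,k$ with $rn\ge k$, \[ \omega(\lceil rn\rceil,k)\ \ge\ \frac{1}{\lceil 1/r\rceil}\,\omega(n,k). \]
   Context: All graphs are finite and simple; $\omega(G)$ and $\alpha(G)$ denote the clique number and independence number of a graph $G$, and $|G|$ its number of vertices. For positive integers $n,k$, the inverse Ramsey number is $\omega(n,k)=\min\{\omega(G): |G|=n \text{ and } \alpha(G)\le k\}$. -}

module Defs where

open import Data.Nat using (ℕ; zero; suc; _≤_; NonZero)
open import Data.Integer as ℤ using (ℤ; +_)
open import Data.Rational using (ℚ; _/_; _<_; 0ℚ; 1ℚ)
open import Data.Fin using (Fin)
open import Data.Fin.Subset using (Subset; _∈_; ∣_∣)
open import Data.Bool using (Bool; true; false)
open import Data.Product using (Σ; ∃; _×_)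
open import Data.Sum using (_⊎_)
open import Data.Empty using (⊥)
open import Relation.Nullary using (¬_)
open import Relation.Binary.PropositionalEquality using (_≡_; _≢_)

record Graph (n : ℕ) : Set where
  field
    adj   : Fin n → Fin n → Bool
    sym   : ∀ i j → adj i j ≡ adj j i
    irrefl : ∀ i → adj i i ≡ false
open Graph public

IsClique : ∀ {n} → Graph n → Subset n → Set
IsClique G S = ∀ i j → i ∈ S → j ∈ S → i ≢ j → adj G i j ≡ true

IsIndependent : ∀ {n} → Graph n → Subset n → Set
IsIndependent G S = ∀ i j → i ∈ S → j ∈ S → i ≢ j → adj G i j ≡ false

IsCliqueNumber : ∀ {n} → Graph n → ℕ → Set
IsCliqueNumber G w =
  (Σ (Subset _) λ S → IsClique G S × ∣ S ∣ ≡ w)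
  × (∀ S → IsClique G S → ∣ S ∣ ≤ w)

IndepAtMost : ∀ {n} → Graph n → ℕ → Set
IndepAtMost G k = ∀ S → IsIndependent G S → ∣ S ∣ ≤ k

-- ω(n,k) = w : w is the minimum of ω(G) over graphs G with |G| = n and α(G) ≤ k
IsInvRamsey : ℕ → ℕ → ℕ → Set
IsInvRamsey n k w =
  (Σ (Graph n) λ G → IndepAtMost G k × IsCliqueNumber G w)
  × (∀ (G : Graph n) (v : ℕ) → IndepAtMost G k → IsCliqueNumber G v → w ≤ v)

-- Real numbers as (two-sided, located) Dedekind cuts of ℚ.
-- L q means q < x, U q means x < q.

record ℝ : Set₁ where
  field
    L U        : ℚ → Set
    inhabitedL : ∃ L
    inhabitedU : ∃ U
    roundedL   : ∀ q → (L q → ∃ λ p → q < p × L p) × ((∃ λ p → q < p × L p) → L q)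
    roundedU   : ∀ q → (U q → ∃ λ p → p < q × U p) × ((∃ λ p → p < q × U p) → U q)
    disjoint   : ∀ q → ¬ (L q × U q)
    located    : ∀ p q → p < q → L p ⊎ U q
open ℝ public

_<ℝ_ : ℚ → ℝ → Set
q <ℝ x = L x q

_ℝ<_ : ℝ → ℚ → Set
x ℝ< q = U x q

_ℝ≤_ : ℝ → ℚ → Set
x ℝ≤ q = ¬ (L x q)

_≤ℝ_ : ℚ → ℝ → Set
q ≤ℝ x = ¬ (U x q)

-- ⌈ r · n ⌉ = m  (n ≥ 1):  m - 1 < r n ≤ m,  i.e.  (m-1)/n < r ≤ m/n
IsCeilMul : ℝ → (n : ℕ) → .{{NonZero n}} → ℕ → Set
IsCeilMul r n m = ((+ m ℤ.- + 1) / n) <ℝ r × r ℝ≤ (+ m / n)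

-- ⌈ 1 / r ⌉ = t  (for r > 0):  t - 1 < 1/r ≤ t,  i.e.  1/t ≤ r < 1/(t-1)
-- (for t = 1 the lower condition 0 < 1/r is automatic from r > 0)
IsCeilInv : ℝ → ℕ → Set
IsCeilInv r zero = ⊥
IsCeilInv r (suc zero) = 1ℚ ≤ℝ r
IsCeilInv r (suc (suc s)) = (+ 1 / suc (suc s)) ≤ℝ r × r ℝ< (+ 1 / suc s)

-- Since m = ⌈rn⌉ ≥ rn and t = ⌈1/r⌉ ≥ 1/r, we have n ≤ t·m.  Take H on m vertices
-- with α(H) ≤ k and ω(H) = ω(m,k), join t copies of H completely to each other and
-- keep n of the t·m vertices.  An independent set of the resulting graph G lies in
-- a single copy, so α(G) ≤ k; a clique meets each copy in a clique of H, so
-- ω(G) ≤ t·ω(m,k).  Minimality of ω(n,k) gives ω(n,k) ≤ ω(G).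
module Submission where

open import Defs
open import Data.Nat using (ℕ; _≤_; _*_; NonZero)
open import Data.Integer using (+_)
open import Data.Rational using (_/_; 0ℚ; 1ℚ)

open import Level using (Level)
open import Data.Nat using (zero; suc; _+_; _<_; _≟_; z≤n; s≤s; s≤s⁻¹; ≢-nonZero⁻¹)
open import Data.Nat.Properties
  using (≤-refl; ≤-reflexive; ≤-trans; ≤-antisym; ≤∧≢⇒<; ≮⇒≥; +-mono-≤; +-suc; n≮0; *-comm; *-identityˡ; _≤?_)
import Data.Integer as ℤ
import Data.Integer.Properties as ℤ
import Data.Rational as ℚ
open import Data.Rational.Properties using (toℚᵘ-cancel-<; toℚᵘ-fromℚᵘ)
open import Data.Rational.Unnormalised using (mkℚᵘ; *<*)
import Data.Rational.Unnormalised.Properties as ℚᵘ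
open import Data.Fin as Fin using (Fin; toℕ; inject≤)
open import Data.Fin.Properties
  using (0≢1+n; toℕ<n; toℕ-injective; inject≤-injective; suc-injective; *↔×; any?; all?)
  renaming (_≟_ to _≟ᶠ_)
open import Data.Fin.Subset using (Subset; _∈_; ∣_∣; inside; outside; _∩_; ∁; _-_; _⊆_)
  renaming (⊥ to ∅)
open import Data.Fin.Subset.Properties
  using (_∈?_; x∈p∩q⁺; x∈p∩q⁻; p∩q⊆p; p∩q⊆q; x∈∁p⇒x∉p; p⊆q⇒∣p∣≤∣q∣;
         ∣p∣≤n; ∣⊥∣≡0; Empty-unique; x∈p∧x≢y⇒x∈p-y; x∈p⇒∣p-x∣<∣p∣; ∉⊥; anySubset?)
open import Data.Vec using ([]; _∷_; tabulate; here; there)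
open import Data.Vec.Properties using (lookup∘tabulate; []=⇒lookup; lookup⇒[]=)
open import Data.Bool using (Bool; true; if_then_else_)
open import Data.Bool.Properties using () renaming (_≟_ to _≟ᵇ_)
open import Data.Product using (Σ; ∃; _×_; _,_; proj₁; proj₂)
open import Data.Sum using (inj₁; inj₂)
open import Function using (_∘_; Injection; Inverse)
open import Function.Properties.Inverse using (↔⇒↣)
open import Relation.Nullary using (yes; no; does; ¬_; ¬?; contradiction)
open import Relation.Nullary.Decidable
  using (_×-dec_; _→-dec_; dec-true; dec-false; decidable-stable)
open import Relation.Unary using (Pred; Decidable)
open import Relation.Binary.PropositionalEquality
  using (_≡_; _≢_; refl; trans; cong; cong₂; subst; subst₂) renaming (sym to ≡-sym)

private
  variable
    ℓ : Level
    n m : ℕ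

select : {P : Pred (Fin n) ℓ} → Decidable P → Subset n
select P? = tabulate (does ∘ P?)

module _ {P : Pred (Fin n) ℓ} (P? : Decidable P) where

  ∈-select⁺ : ∀ {i} → P i → i ∈ select P?
  ∈-select⁺ {i} p = lookup⇒[]= i (select P?) (trans (lookup∘tabulate _ i) (dec-true (P? i) p))

  ∈-select⁻ : ∀ {i} → i ∈ select P? → P i
  ∈-select⁻ {i} i∈ with P? i | trans (≡-sym (lookup∘tabulate _ i)) ([]=⇒lookup i∈)
  ... | yes p | _ = p
  ... | no _  | ()

module _ (f : Fin n → Fin m) (S : Subset n) where

  private
    inImage? : Decidable (λ y → ∃ λ i → i ∈ S × f i ≡ y)
    inImage? y = any? λ i → (i ∈? S) ×-dec (f i ≟ᶠ y)

  image : Subset m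
  image = select inImage?

  ∈-image⁺ : ∀ {i} → i ∈ S → f i ∈ image
  ∈-image⁺ {i} i∈S = ∈-select⁺ inImage? (i , i∈S , refl)

  ∈-image⁻ : ∀ {y} → y ∈ image → ∃ λ i → i ∈ S × f i ≡ y
  ∈-image⁻ = ∈-select⁻ inImage?

InjectiveOn : (Fin n → Fin m) → Subset n → Set
InjectiveOn f S = ∀ {i j} → i ∈ S → j ∈ S → f i ≡ f j → i ≡ j

-- The head of S is sent into T, and the tail injects into T minus its image.
injectiveOn⇒∣p∣≤∣q∣ : ∀ (f : Fin n → Fin m) S T →
                      (∀ {i} → i ∈ S → f i ∈ T) → InjectiveOn f S → ∣ S ∣ ≤ ∣ T ∣
injectiveOn⇒∣p∣≤∣q∣ f [] T _ _ = z≤n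
injectiveOn⇒∣p∣≤∣q∣ f (outside ∷ S) T into inj =
  injectiveOn⇒∣p∣≤∣q∣ (f ∘ Fin.suc) S T (into ∘ there)
    (λ i∈ j∈ e → suc-injective (inj (there i∈) (there j∈) e))
injectiveOn⇒∣p∣≤∣q∣ f (inside ∷ S) T into inj =
  ≤-trans (s≤s (injectiveOn⇒∣p∣≤∣q∣ (f ∘ Fin.suc) S (T - f Fin.zero) into′ inj′))
          (x∈p⇒∣p-x∣<∣p∣ (into here))
  where
  into′ : ∀ {i} → i ∈ S → f (Fin.suc i) ∈ T - f Fin.zero
  into′ i∈ = x∈p∧x≢y⇒x∈p-y (into (there i∈)) (λ e → 0≢1+n (≡-sym (inj (there i∈) here e)))
  inj′ : InjectiveOn (f ∘ Fin.suc) S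
  inj′ i∈ j∈ e = suc-injective (inj (there i∈) (there j∈) e)

∣p∣≤∣image∣ : ∀ (f : Fin n → Fin m) {S} → InjectiveOn f S → ∣ S ∣ ≤ ∣ image f S ∣
∣p∣≤∣image∣ f {S} = injectiveOn⇒∣p∣≤∣q∣ f S (image f S) (∈-image⁺ f S)

∣p∣≤∣p∩q∣+∣p∩∁q∣ : ∀ (p q : Subset n) → ∣ p ∣ ≤ ∣ p ∩ q ∣ + ∣ p ∩ ∁ q ∣
∣p∣≤∣p∩q∣+∣p∩∁q∣ [] [] = z≤n
∣p∣≤∣p∩q∣+∣p∩∁q∣ (inside ∷ p) (inside ∷ q) = s≤s (∣p∣≤∣p∩q∣+∣p∩∁q∣ p q)
∣p∣≤∣p∩q∣+∣p∩∁q∣ (inside ∷ p) (outside ∷ q) =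
  ≤-trans (s≤s (∣p∣≤∣p∩q∣+∣p∩∁q∣ p q)) (≤-reflexive (≡-sym (+-suc _ _)))
∣p∣≤∣p∩q∣+∣p∩∁q∣ (outside ∷ p) (_ ∷ q) = ∣p∣≤∣p∩q∣+∣p∩∁q∣ p q

module _ (f : Fin n → ℕ) (c : ℕ) where

  fibre : Subset n
  fibre = select (λ i → f i ≟ c)

  ∈-fibre⁺ : ∀ {i} → f i ≡ c → i ∈ fibre
  ∈-fibre⁺ = ∈-select⁺ (λ i → f i ≟ c)

  ∈-fibre⁻ : ∀ {i} → i ∈ fibre → f i ≡ c
  ∈-fibre⁻ = ∈-select⁻ (λ i → f i ≟ c)

∣p∣≤u*a-byFibres : ∀ (f : Fin n → ℕ) {a} u S → (∀ {i} → i ∈ S → f i < u) →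
                   (∀ c → ∣ S ∩ fibre f c ∣ ≤ a) → ∣ S ∣ ≤ u * a
∣p∣≤u*a-byFibres {n} f zero S bounded _ =
  ≤-reflexive (trans (cong ∣_∣ (Empty-unique (λ (i , i∈) → n≮0 (bounded i∈)))) (∣⊥∣≡0 n))
∣p∣≤u*a-byFibres {n} f {a} (suc u) S bounded small =
  ≤-trans (∣p∣≤∣p∩q∣+∣p∩∁q∣ S (fibre f u))
          (+-mono-≤ (small u) (∣p∣≤u*a-byFibres f u S′ bounded′ small′))
  where
  S′ : Subset n
  S′ = S ∩ ∁ (fibre f u)
  bounded′ : ∀ {i} → i ∈ S′ → f i < u
  bounded′ i∈ with i∈S , i∉fu ← x∈p∩q⁻ S _ i∈ =
    ≤∧≢⇒< (s≤s⁻¹ (bounded i∈S)) (x∈∁p⇒x∉p i∉fu ∘ ∈-fibre⁺ f u)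
  small′ : ∀ c → ∣ S′ ∩ fibre f c ∣ ≤ a
  small′ c = ≤-trans (p⊆q⇒∣p∣≤∣q∣ λ i∈ → x∈p∩q⁺ (p∩q⊆p S _ (p∩q⊆p S′ _ i∈) , p∩q⊆q S′ _ i∈))
                     (small c)

greatest : {P : Pred ℕ ℓ} → Decidable P → P 0 →
           ∀ b → (∀ {w} → P w → w ≤ b) → ∃ λ w → P w × (∀ {v} → P v → v ≤ w)
greatest P? p₀ zero    bounded = 0 , p₀ , bounded
greatest P? p₀ (suc b) bounded with P? (suc b)
... | yes p = suc b , p , bounded
... | no ¬p = greatest P? p₀ b λ {w} pw → s≤s⁻¹ (≤∧≢⇒< (bounded pw) λ { refl → ¬p pw })

module _ (G : Graph n) where

  isClique? : Decidable (IsClique G)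
  isClique? S = all? λ i → all? λ j →
    (i ∈? S) →-dec (j ∈? S) →-dec ¬? (i ≟ᶠ j) →-dec (adj G i j ≟ᵇ true)

  HasCliqueOfSize≥ : ℕ → Set
  HasCliqueOfSize≥ w = ∃ λ S → IsClique G S × w ≤ ∣ S ∣

  hasCliqueOfSize≥? : Decidable HasCliqueOfSize≥
  hasCliqueOfSize≥? w = anySubset? λ S → isClique? S ×-dec (w ≤? ∣ S ∣)

  cliqueNumber : ∃ (IsCliqueNumber G)
  cliqueNumber
    with w , (S , clique , w≤∣S∣) , maximal ←
         greatest hasCliqueOfSize≥? (∅ , (λ _ _ i∈∅ → contradiction i∈∅ ∉⊥) , z≤n) n
                  (λ (S , _ , w≤∣S∣) → ≤-trans w≤∣S∣ (∣p∣≤n S))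
    = w , (S , clique , ≤-antisym (maximal (S , clique , ≤-refl)) w≤∣S∣)
        , λ S′ clique′ → maximal (S′ , clique′ , ≤-refl)

-- IsClique G is definitionally Homogeneous G true, IsIndependent G is Homogeneous G false.
Homogeneous : Graph n → Bool → Subset n → Set
Homogeneous G b S = ∀ i j → i ∈ S → j ∈ S → i ≢ j → adj G i j ≡ b

homogeneous-⊆ : ∀ (G : Graph n) {b S T} → T ⊆ S → Homogeneous G b S → Homogeneous G b T
homogeneous-⊆ G T⊆S hom i j i∈ j∈ = hom i j (T⊆S i∈) (T⊆S j∈)

record EmbeddingOn (G : Graph n) (H : Graph m) (f : Fin n → Fin m) (S : Subset n) : Set where
  field
    injectiveOn : InjectiveOn f S
    adj-≡       : ∀ {i j} → i ∈ S → j ∈ S → adj G i j ≡ adj H (f i) (f j)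

module _ {G : Graph n} {H : Graph m} {f : Fin n → Fin m} {S : Subset n}
         (emb : EmbeddingOn G H f S) where

  open EmbeddingOn emb

  homogeneous-image : ∀ {b} → Homogeneous G b S → Homogeneous H b (image f S)
  homogeneous-image {b} hom x y x∈ y∈ x≢y
    with i , i∈S , refl ← ∈-image⁻ f S x∈ | j , j∈S , refl ← ∈-image⁻ f S y∈ =
    trans (≡-sym (adj-≡ i∈S j∈S)) (hom i j i∈S j∈S (x≢y ∘ cong f))

  homogeneous-bound : ∀ {b a} → Homogeneous G b S →
                      (∀ T → Homogeneous H b T → ∣ T ∣ ≤ a) → ∣ S ∣ ≤ a
  homogeneous-bound hom bound =
    ≤-trans (∣p∣≤∣image∣ f injectiveOn) (bound (image f S) (homogeneous-image hom))

-- Vertex i of the join is the copy of the vertex `vertex i` of H lying in layer `layer i`.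
module Join (H : Graph m) (layer : Fin n → ℕ) (vertex : Fin n → Fin m)
            (layer-vertex-injective : ∀ {i j} → layer i ≡ layer j → vertex i ≡ vertex j → i ≡ j)
            where

  join-adj : Fin n → Fin n → Bool
  join-adj i j = if does (layer i ≟ layer j) then adj H (vertex i) (vertex j) else true

  join-adj-sameLayer : ∀ {i j} → layer i ≡ layer j → join-adj i j ≡ adj H (vertex i) (vertex j)
  join-adj-sameLayer {i} {j} e rewrite dec-true (layer i ≟ layer j) e = refl

  join-adj-otherLayer : ∀ {i j} → layer i ≢ layer j → join-adj i j ≡ true
  join-adj-otherLayer {i} {j} ne rewrite dec-false (layer i ≟ layer j) ne = refl

  join-sym : ∀ i j → join-adj i j ≡ join-adj j i
  join-sym i j with layer i ≟ layer j
  ... | yes e = trans (join-adj-sameLayer e)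
                  (trans (Graph.sym H _ _) (≡-sym (join-adj-sameLayer (≡-sym e))))
  ... | no ne = trans (join-adj-otherLayer ne) (≡-sym (join-adj-otherLayer (ne ∘ ≡-sym)))

  join : Graph n
  join = record
    { adj    = join-adj
    ; sym    = join-sym
    ; irrefl = λ i → trans (join-adj-sameLayer refl) (irrefl H (vertex i))
    }

  SingleLayer : Subset n → Set
  SingleLayer S = ∀ {i j} → i ∈ S → j ∈ S → layer i ≡ layer j

  singleLayer-embedding : ∀ {S} → SingleLayer S → EmbeddingOn join H vertex S
  singleLayer-embedding single = record
    { injectiveOn = λ i∈ j∈ → layer-vertex-injective (single i∈ j∈)
    ; adj-≡       = λ i∈ j∈ → join-adj-sameLayer (single i∈ j∈)
    }

  independent-singleLayer : ∀ {S} → IsIndependent join S → SingleLayer S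
  independent-singleLayer independent {i} {j} i∈ j∈ =
    decidable-stable (layer i ≟ layer j) λ ne →
      contradiction (trans (≡-sym (join-adj-otherLayer ne)) (independent i j i∈ j∈ (ne ∘ cong layer)))
                    λ ()

  join-indepAtMost : ∀ {k} → IndepAtMost H k → IndepAtMost join k
  join-indepAtMost α≤k S independent =
    homogeneous-bound (singleLayer-embedding (independent-singleLayer independent)) independent α≤k

  join-ω≤ : ∀ {t a v} → (∀ i → layer i < t) → (∀ T → IsClique H T → ∣ T ∣ ≤ a) →
            IsCliqueNumber join v → v ≤ t * a
  join-ω≤ {t} layer<t ω≤a ((S , clique , refl) , _) =
    ∣p∣≤u*a-byFibres layer t S (λ {i} _ → layer<t i) λ c →
      homogeneous-bound (singleLayer-embedding (fibre-singleLayer c))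
                        (homogeneous-⊆ join (p∩q⊆p S _) clique) ω≤a
    where
    fibre-singleLayer : ∀ c → SingleLayer (S ∩ fibre layer c)
    fibre-singleLayer c i∈ j∈ =
      trans (∈-fibre⁻ layer c (p∩q⊆q S _ i∈)) (≡-sym (∈-fibre⁻ layer c (p∩q⊆q S _ j∈)))

+p/d<+q/e : ∀ p q d e → p * suc e < q * suc d → (+ p / suc d) ℚ.< (+ q / suc e)
+p/d<+q/e p q d e lt =
  toℚᵘ-cancel-< (ℚᵘ.<-respˡ-≃ (ℚᵘ.≃-sym (toℚᵘ-fromℚᵘ (mkℚᵘ (+ p) d)))
                (ℚᵘ.<-respʳ-≃ (ℚᵘ.≃-sym (toℚᵘ-fromℚᵘ (mkℚᵘ (+ q) e)))
                (*<* (subst₂ ℤ._<_ (ℤ.pos-* p (suc e)) (ℤ.pos-* q (suc d)) (ℤ.+<+ lt)))))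

q≤r≤p⇒p≮q : ∀ (r : ℝ) {p q} → q ≤ℝ r → r ℝ≤ p → ¬ (p ℚ.< q)
q≤r≤p⇒p≮q r q≤r r≤p p<q with located r _ _ p<q
... | inj₁ p<r = r≤p p<r
... | inj₂ r<q = q≤r r<q

isCeilInv⇒1/t≤r : ∀ {r} t → IsCeilInv r (suc t) → (+ 1 / suc t) ≤ℝ r
isCeilInv⇒1/t≤r zero    1≤r         = 1≤r
isCeilInv⇒1/t≤r (suc t) (1/t≤r , _) = 1/t≤r

-- m/n ≥ r ≥ 1/t.
isCeilMul-isCeilInv⇒n≤t*m : ∀ r n .{{_ : NonZero n}} m t →
                            IsCeilMul r n m → IsCeilInv r t → n ≤ t * m
isCeilMul-isCeilInv⇒n≤t*m r zero m t _ _ = contradiction refl (≢-nonZero⁻¹ zero)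
isCeilMul-isCeilInv⇒n≤t*m r (suc n) m (suc t) (_ , r≤m/n) ceilInv =
  ≮⇒≥ λ t*m<n → q≤r≤p⇒p≮q r (isCeilInv⇒1/t≤r t ceilInv) r≤m/n
    (+p/d<+q/e m 1 n t (subst₂ _<_ (*-comm (suc t) m) (≡-sym (*-identityˡ (suc n))) t*m<n))

layered-embedding : ∀ {t} → n ≤ t * m → Σ (Fin n → ℕ) λ layer → Σ (Fin n → Fin m) λ vertex →
                      (∀ i → layer i < t) ×
                      (∀ {i j} → layer i ≡ layer j → vertex i ≡ vertex j → i ≡ j)
layered-embedding {n} {m} {t} n≤t*m =
  toℕ ∘ proj₁ ∘ pack , proj₂ ∘ pack , (λ i → toℕ<n (proj₁ (pack i))) ,
  λ {i} {j} e₁ e₂ → inject≤-injective n≤t*m n≤t*m i j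
                      (Injection.injective (↔⇒↣ *↔×) (cong₂ _,_ (toℕ-injective e₁) e₂))
  where
  pack : Fin n → Fin t × Fin m
  pack i = Inverse.to *↔× (inject≤ i n≤t*m)

lemma2p1 : (r : ℝ) → 0ℚ <ℝ r → r ℝ≤ 1ℚ
           → (n k : ℕ) → .{{_ : NonZero n}} → 1 ≤ k → (+ k / n) ≤ℝ r
           → (m t : ℕ) → IsCeilMul r n m → IsCeilInv r t
           → (a b : ℕ) → IsInvRamsey m k a → IsInvRamsey n k b
           → b ≤ t * a
lemma2p1 r _ _ n k _ _ m t ceilMul ceilInv a b ((H , α[H]≤k , _ , ω[H]≤a) , _) (_ , b-minimal)
  with layer , vertex , layer<t , injective ←
         layered-embedding {t = t} (isCeilMul-isCeilInv⇒n≤t*m r n m t ceilMul ceilInv)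
  = let open Join H layer vertex injective
        v , ω[join]≡v = cliqueNumber join
    in ≤-trans (b-minimal join v (join-indepAtMost α[H]≤k) ω[join]≡v)
               (join-ω≤ layer<t ω[H]≤a ω[join]≡v)
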